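{- Let $\mathcal{F}$ be a crossing biset-family on $V$, let $\hat C_1,\hat C_2$ be distinct cores of $\mathcal{F}$, and let $\hat S_1\in\mathcal{F}(\hat C_1)$ and $\hat S_2\in\mathcal{F}(\hat C_2)$. Then $\hat S_1,\hat S_2$ do not cross. Consequently, no directed edge covers both $\hat S_1$ and $\hat S_2$.
   Context: A biset on $V$ is a pair $\hat S=(S,S^+)$ with $S\subseteq S^+\subseteq V$, proper if $S\ne\emptyset\ne V\setminus S^+$; all biset-families consist of proper bisets. $\hat X,\hat Y$ cross if $X\cap Y\ne\emptyset$ and $X^+\cup Y^+\neq V$; $\hat X\cap\hat Y=(X\cap Y,X^+\cap Y^+)$, $\hat X\cup\hat Y=(X\cup Y,X^+\cup Y^+)$; $\mathcal{F}$ is crossing if $\hat X\cap\hat Y,\hat X\cup\hat Y\in\mathcal{F}$ whenever $\hat X,\hat Y\in\mathcal{F}$ cross. Containment: $\hat X\subseteq\hat Y$ if $X\subset Y$, or $X=Y$ and $X^+\subseteq Y^+$. A core of $\mathcal{F}$ is a member of $\mathcal{F}$ containing no other member. For a core $\hat C$, $\mathcal{F}(\hat C)$ is the family of members of $\mathcal{F}$ that contain $\hat C$ and contain no other core. A directed edge $uv$ covers $\hat S$ if $u\in S$ and $v\in V\setminus S^+$. -}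

module Defs where

open import Data.Nat using (ℕ)
open import Data.Fin using (Fin)
open import Data.Fin.Subset using (Subset; _∈_; _∉_; _⊆_; _∩_; _∪_; ⊤; Nonempty)
open import Data.Product using (_×_; _,_; proj₁; proj₂; ∃)
open import Data.Sum using (_⊎_)
open import Relation.Nullary using (¬_)
open import Relation.Binary.PropositionalEquality using (_≡_; _≢_)

Biset : ℕ → Set
Biset n = Subset n × Subset n

module _ {n : ℕ} where

  inner : Biset n → Subset n
  inner = proj₁

  outer : Biset n → Subset n
  outer = proj₂

  IsProperBiset : Biset n → Set
  IsProperBiset (S , S⁺) = (S ⊆ S⁺) × Nonempty S × (∃ λ v → v ∉ S⁺)

  IsBisetFamily : (Biset n → Set) → Set
  IsBisetFamily F = ∀ X → F X → IsProperBiset X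

  _∩ᵇ_ : Biset n → Biset n → Biset n
  (X , X⁺) ∩ᵇ (Y , Y⁺) = (X ∩ Y , X⁺ ∩ Y⁺)

  _∪ᵇ_ : Biset n → Biset n → Biset n
  (X , X⁺) ∪ᵇ (Y , Y⁺) = (X ∪ Y , X⁺ ∪ Y⁺)

  Cross : Biset n → Biset n → Set
  Cross (X , X⁺) (Y , Y⁺) = Nonempty (X ∩ Y) × ((X⁺ ∪ Y⁺) ≢ ⊤)

  IsCrossing : (Biset n → Set) → Set
  IsCrossing F = ∀ X Y → F X → F Y → Cross X Y → F (X ∩ᵇ Y) × F (X ∪ᵇ Y)

  _⊆ᵇ_ : Biset n → Biset n → Set
  (X , X⁺) ⊆ᵇ (Y , Y⁺) = ((X ⊆ Y) × (X ≢ Y)) ⊎ ((X ≡ Y) × (X⁺ ⊆ Y⁺))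

  IsCore : (Biset n → Set) → Biset n → Set
  IsCore F C = F C × (∀ X → F X → X ⊆ᵇ C → X ≡ C)

  InCoreFamily : (Biset n → Set) → Biset n → Biset n → Set
  InCoreFamily F C S = F S × C ⊆ᵇ S × (∀ C′ → IsCore F C′ → C′ ⊆ᵇ S → C′ ≡ C)

  Covers : Fin n → Fin n → Biset n → Set
  Covers u v (S , S⁺) = (u ∈ S) × (v ∉ S⁺)

-- The intersection of two crossing members S₁ ∈ F(C₁), S₂ ∈ F(C₂) is again a
-- member of F, and, F being finite, it contains some core C.  Then C lies
-- below both S₁ and S₂, so C = C₁ and C = C₂, contradicting C₁ ≠ C₂.  An
-- edge covering both S₁ and S₂ would make them cross.
module Submission where

open import Defs
open import Data.Bool.Properties using () renaming (_≟_ to _≟𝔹_)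
open import Data.Empty using (⊥-elim)
open import Data.Fin using (Fin)
open import Data.Fin.Subset using (Subset; inside; outside; _∈_; _⊆_; _∩_; ∣_∣)
open import Data.Fin.Subset.Properties
  using (drop-∷-⊆; p⊆q⇒∣p∣≤∣q∣; ⊆-trans; ⊆-antisym; p∩q⊆p; p∩q⊆q; x∈p∩q⁺; x∈p∪q⁻; ∈⊤)
open import Data.Nat using (ℕ; _<_; s≤s)
open import Data.Nat.Induction using (<-wellFounded)
open import Data.Product using (_×_; _,_; proj₁)
open import Data.Product.Properties using () renaming (≡-dec to ×-≡-dec)
open import Data.Product.Relation.Binary.Lex.Strict using (×-Lex; ×-wellFounded)
open import Data.Sum using (inj₁; inj₂; [_,_])
open import Data.Vec using ([]; _∷_; here)
open import Data.Vec.Properties using () renaming (≡-dec to Vec-≡-dec)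
open import Function using (_on_)
open import Induction.WellFounded using (Acc; acc; WellFounded)
open import Relation.Binary.Construct.On as On using ()
open import Relation.Binary.Definitions using (DecidableEquality)
open import Relation.Binary.PropositionalEquality
  using (_≡_; _≢_; refl; sym; trans; subst; cong)
open import Relation.Nullary using (¬_; yes; no)

private
  variable
    n : ℕ

p⊆q∧p≢q⇒∣p∣<∣q∣ : {p q : Subset n} → p ⊆ q → p ≢ q → ∣ p ∣ < ∣ q ∣
p⊆q∧p≢q⇒∣p∣<∣q∣ {p = []}          {[]}          _   p≢q = ⊥-elim (p≢q refl)
p⊆q∧p≢q⇒∣p∣<∣q∣ {p = outside ∷ p} {outside ∷ q} p⊆q p≢q =
  p⊆q∧p≢q⇒∣p∣<∣q∣ (drop-∷-⊆ p⊆q) (λ e → p≢q (cong (outside ∷_) e))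
p⊆q∧p≢q⇒∣p∣<∣q∣ {p = outside ∷ p} {inside ∷ q}  p⊆q _   = s≤s (p⊆q⇒∣p∣≤∣q∣ (drop-∷-⊆ p⊆q))
p⊆q∧p≢q⇒∣p∣<∣q∣ {p = inside ∷ p}  {outside ∷ q} p⊆q _   with () ← p⊆q here
p⊆q∧p≢q⇒∣p∣<∣q∣ {p = inside ∷ p}  {inside ∷ q}  p⊆q p≢q =
  s≤s (p⊆q∧p≢q⇒∣p∣<∣q∣ (drop-∷-⊆ p⊆q) (λ e → p≢q (cong (inside ∷_) e)))

infix 4 _≟ˢ_ _≟ᵇ_

_≟ˢ_ : DecidableEquality (Subset n)
_≟ˢ_ = Vec-≡-dec _≟𝔹_

_≟ᵇ_ : DecidableEquality (Biset n)
_≟ᵇ_ = ×-≡-dec _≟ˢ_ _≟ˢ_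

⊆ᵇ-refl : (X : Biset n) → X ⊆ᵇ X
⊆ᵇ-refl X = inj₂ (refl , λ x∈X⁺ → x∈X⁺)

⊆ᵇ-trans : {X Y Z : Biset n} → X ⊆ᵇ Y → Y ⊆ᵇ Z → X ⊆ᵇ Z
⊆ᵇ-trans {Y = Y , _} (inj₁ (X⊆Y , X≢Y)) (inj₁ (Y⊆Z , Y≢Z)) =
  inj₁ (⊆-trans X⊆Y Y⊆Z , λ X≡Z → Y≢Z (⊆-antisym Y⊆Z (subst (_⊆ Y) X≡Z X⊆Y)))
⊆ᵇ-trans (inj₁ (X⊆Y , X≢Y)) (inj₂ (refl , _))  = inj₁ (X⊆Y , X≢Y)
⊆ᵇ-trans (inj₂ (refl , _))  (inj₁ (Y⊆Z , Y≢Z)) = inj₁ (Y⊆Z , Y≢Z)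
⊆ᵇ-trans (inj₂ (refl , X⁺⊆Y⁺)) (inj₂ (refl , Y⁺⊆Z⁺)) = inj₂ (refl , ⊆-trans X⁺⊆Y⁺ Y⁺⊆Z⁺)

∩ᵇ⊆ᵇˡ : (X Y : Biset n) → (X ∩ᵇ Y) ⊆ᵇ X
∩ᵇ⊆ᵇˡ (X , X⁺) (Y , Y⁺) with X ∩ Y ≟ˢ X
... | yes X∩Y≡X = inj₂ (X∩Y≡X , p∩q⊆p X⁺ Y⁺)
... | no  X∩Y≢X = inj₁ (p∩q⊆p X Y , X∩Y≢X)

∩ᵇ⊆ᵇʳ : (X Y : Biset n) → (X ∩ᵇ Y) ⊆ᵇ Y
∩ᵇ⊆ᵇʳ (X , X⁺) (Y , Y⁺) with X ∩ Y ≟ˢ Y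
... | yes X∩Y≡Y = inj₂ (X∩Y≡Y , p∩q⊆q X⁺ Y⁺)
... | no  X∩Y≢Y = inj₁ (p∩q⊆q X Y , X∩Y≢Y)

size : Biset n → ℕ × ℕ
size (X , X⁺) = ∣ X ∣ , ∣ X⁺ ∣

_<ₗₑₓ_ : ℕ × ℕ → ℕ × ℕ → Set
_<ₗₑₓ_ = ×-Lex _≡_ _<_ _<_

⊆ᵇ∧≢⇒size<ₗₑₓ : {X Y : Biset n} → X ⊆ᵇ Y → X ≢ Y → size X <ₗₑₓ size Y
⊆ᵇ∧≢⇒size<ₗₑₓ (inj₁ (X⊆Y , X≢Y)) _ = inj₁ (p⊆q∧p≢q⇒∣p∣<∣q∣ X⊆Y X≢Y)
⊆ᵇ∧≢⇒size<ₗₑₓ (inj₂ (refl , X⁺⊆Y⁺)) X̂≢Ŷ =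
  inj₂ (refl , p⊆q∧p≢q⇒∣p∣<∣q∣ X⁺⊆Y⁺ (λ X⁺≡Y⁺ → X̂≢Ŷ (cong (_ ,_) X⁺≡Y⁺)))

size<ₗₑₓ-wellFounded : WellFounded {A = Biset n} (_<ₗₑₓ_ on size)
size<ₗₑₓ-wellFounded = On.wellFounded size (×-wellFounded <-wellFounded <-wellFounded)

module _ (F : Biset n → Set) where

  -- Only the double negation is constructive, since F need not be decidable.
  -- Strict containment lowers size lexicographically, so descent terminates.
  member-contains-core : ∀ X → F X → ¬ (∀ C → IsCore F C → ¬ C ⊆ᵇ X)
  member-contains-core X = go X (size<ₗₑₓ-wellFounded X)
    where
    go : ∀ X → Acc (_<ₗₑₓ_ on size) X → F X → ¬ (∀ C → IsCore F C → ¬ C ⊆ᵇ X)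
    go X (acc smaller) FX noCore = noCore X (FX , minimal) (⊆ᵇ-refl X)
      where
      minimal : ∀ Y → F Y → Y ⊆ᵇ X → Y ≡ X
      minimal Y FY Y⊆X with Y ≟ᵇ X
      ... | yes Y≡X = Y≡X
      ... | no  Y≢X = ⊥-elim (go Y (smaller (⊆ᵇ∧≢⇒size<ₗₑₓ Y⊆X Y≢X)) FY
                         λ C cC C⊆Y → noCore C cC (⊆ᵇ-trans C⊆Y Y⊆X))

  no-member-below-distinct-core-families :
    {C₁ C₂ S₁ S₂ : Biset n} → C₁ ≢ C₂ → InCoreFamily F C₁ S₁ → InCoreFamily F C₂ S₂ →
    ∀ X → F X → X ⊆ᵇ S₁ → ¬ X ⊆ᵇ S₂
  no-member-below-distinct-core-families C₁≢C₂ (_ , _ , only₁) (_ , _ , only₂) X FX X⊆S₁ X⊆S₂ =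
    member-contains-core X FX λ C cC C⊆X →
      C₁≢C₂ (trans (sym (only₁ C cC (⊆ᵇ-trans C⊆X X⊆S₁))) (only₂ C cC (⊆ᵇ-trans C⊆X X⊆S₂)))

common-cover⇒Cross : {u v : Fin n} (S T : Biset n) → Covers u v S → Covers u v T → Cross S T
common-cover⇒Cross (S , S⁺) (T , T⁺) (u∈S , v∉S⁺) (u∈T , v∉T⁺) =
  (_ , x∈p∩q⁺ (u∈S , u∈T)) ,
  λ S⁺∪T⁺≡⊤ → [ v∉S⁺ , v∉T⁺ ] (x∈p∪q⁻ S⁺ T⁺ (subst (_ ∈_) (sym S⁺∪T⁺≡⊤) ∈⊤))

lemma2 : (n : ℕ) (F : Biset n → Set) → IsBisetFamily F → IsCrossing F →
    (C₁ C₂ S₁ S₂ : Biset n) → IsCore F C₁ → IsCore F C₂ → C₁ ≢ C₂ →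
    InCoreFamily F C₁ S₁ → InCoreFamily F C₂ S₂ →
    ¬ Cross S₁ S₂ × (∀ (u v : Fin n) → ¬ (Covers u v S₁ × Covers u v S₂))
lemma2 n F _ crossing C₁ C₂ S₁ S₂ _ _ C₁≢C₂ S₁∈F⟨C₁⟩ S₂∈F⟨C₂⟩ =
  noCross , λ u v (cov₁ , cov₂) → noCross (common-cover⇒Cross S₁ S₂ cov₁ cov₂)
  where
  noCross : ¬ Cross S₁ S₂
  noCross S₁⋈S₂ =
    no-member-below-distinct-core-families F C₁≢C₂ S₁∈F⟨C₁⟩ S₂∈F⟨C₂⟩ (S₁ ∩ᵇ S₂)
      (proj₁ (crossing S₁ S₂ (proj₁ S₁∈F⟨C₁⟩) (proj₁ S₂∈F⟨C₂⟩) S₁⋈S₂))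
      (∩ᵇ⊆ᵇˡ S₁ S₂) (∩ᵇ⊆ᵇʳ S₁ S₂)
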